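{- Let $F\colon\mathbf{Set}\to\mathbf{Set}$ be a functor and $\langle X_1,\xi_1\rangle$, $\langle X_2,\xi_2\rangle$ be $F$-coalgebras. If $R\subseteq X_1\times X_2$ is a bitotal cocongruence between $\langle X_1,\xi_1\rangle$ and $\langle X_2,\xi_2\rangle$, then $R$ is a precocongruence.
   Context: An $F$-coalgebra is $\langle X,\xi\rangle$ with $\xi\colon X\to F(X)$; $f$ is a coalgebra morphism if $F(f)\circ\xi_1=\xi_2\circ f$. $R$ is a cocongruence if $R=\{(x_1,x_2)\mid f_1(x_1)=f_2(x_2)\}$ for some coalgebra $\langle Y,\gamma\rangle$ and coalgebra morphisms $f_i\colon\langle X_i,\xi_i\rangle\to\langle Y,\gamma\rangle$. $R$ is bitotal if both projections $R\to X_i$ are surjective. The pushout of $R$ in $\mathbf{Set}$ is $\langle P,p_1,p_2\rangle$ with $P=(X_1+X_2)/\theta$, $\theta$ the equivalence relation generated by $(\iota_1(x_1),\iota_2(x_2))$ for $(x_1,x_2)\in R$, $p_i$ inclusion followed by quotient; $R$ is a precocongruence if some $\lambda\colon P\to F(P)$ makes $p_1,p_2$ coalgebra morphisms. -}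

module Defs where

open import Data.Product using (Σ; ∃; _×_; _,_)
open import Data.Sum using (_⊎_; inj₁; inj₂)
open import Function using (_∘_; id)
open import Relation.Binary.PropositionalEquality using (_≡_)
open import Relation.Binary.Construct.Closure.Equivalence using (EqClosure)

-- An endofunctor on Set.  Morphisms of Set are functions, identified
-- extensionally (pointwise), so the functor laws and congruence are stated pointwise.
record SetFunctor : Set₁ where
  field
    F₀   : Set → Set
    fmap : {A B : Set} → (A → B) → F₀ A → F₀ B
    fmap-cong : {A B : Set} {f g : A → B} → (∀ a → f a ≡ g a) → ∀ u → fmap f u ≡ fmap g u
    fmap-id   : {A : Set} (u : F₀ A) → fmap id u ≡ u
    fmap-∘    : {A B C : Set} (g : B → C) (f : A → B) (u : F₀ A) →
                fmap (g ∘ f) u ≡ fmap g (fmap f u)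

open SetFunctor public

record Coalgebra (F : SetFunctor) : Set₁ where
  constructor ⟨_,_⟩
  field
    Carrier : Set
    str     : Carrier → F₀ F Carrier

open Coalgebra public

IsCoalgMorphism : (F : SetFunctor) (C₁ C₂ : Coalgebra F) →
                  (Carrier C₁ → Carrier C₂) → Set
IsCoalgMorphism F C₁ C₂ f = ∀ x → fmap F f (str C₁ x) ≡ str C₂ (f x)

Relation : Set → Set → Set₁
Relation X₁ X₂ = X₁ → X₂ → Set

Bitotal : {X₁ X₂ : Set} → Relation X₁ X₂ → Set
Bitotal {X₁} {X₂} R = (∀ x₁ → ∃ λ x₂ → R x₁ x₂) × (∀ x₂ → ∃ λ x₁ → R x₁ x₂)

Cocongruence : (F : SetFunctor) (C₁ C₂ : Coalgebra F) →
               Relation (Carrier C₁) (Carrier C₂) → Set₁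
Cocongruence F C₁ C₂ R =
  Σ (Coalgebra F) λ D →
  Σ (Carrier C₁ → Carrier D) λ f₁ →
  Σ (Carrier C₂ → Carrier D) λ f₂ →
    IsCoalgMorphism F C₁ D f₁ × IsCoalgMorphism F C₂ D f₂ ×
    (∀ x₁ x₂ → (R x₁ x₂ → f₁ x₁ ≡ f₂ x₂) × (f₁ x₁ ≡ f₂ x₂ → R x₁ x₂))

data Gen {X₁ X₂ : Set} (R : Relation X₁ X₂) : X₁ ⊎ X₂ → X₁ ⊎ X₂ → Set where
  gen : ∀ {x₁ x₂} → R x₁ x₂ → Gen R (inj₁ x₁) (inj₂ x₂)

θ : {X₁ X₂ : Set} (R : Relation X₁ X₂) → X₁ ⊎ X₂ → X₁ ⊎ X₂ → Set
θ R = EqClosure (Gen R)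

IsQuotientBy : {X₁ X₂ : Set} (R : Relation X₁ X₂) (P : Set) → (X₁ ⊎ X₂ → P) → Set
IsQuotientBy R P q =
  (∀ p → ∃ λ z → q z ≡ p) ×
  (∀ z w → (q z ≡ q w → θ R z w) × (θ R z w → q z ≡ q w))

-- R is a precocongruence: on the pushout P = (X₁+X₂)/θ with pᵢ = q ∘ ιᵢ
-- there is λ : P → F(P) making p₁, p₂ coalgebra morphisms.
-- (Quotient types are unavailable, so P is any quotient presentation; all
-- such are canonically isomorphic.)
Precocongruence : (F : SetFunctor) (C₁ C₂ : Coalgebra F) →
                  Relation (Carrier C₁) (Carrier C₂) → Set₁
Precocongruence F C₁ C₂ R =
  (P : Set) (q : Carrier C₁ ⊎ Carrier C₂ → P) → IsQuotientBy R P q →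
  Σ (P → F₀ F P) λ lam →
    IsCoalgMorphism F C₁ ⟨ P , lam ⟩ (q ∘ inj₁) ×
    IsCoalgMorphism F C₂ ⟨ P , lam ⟩ (q ∘ inj₂)

module Submission where

-- Let ⟨D, γ⟩ with morphisms f₁, f₂ witness that R is a
-- cocongruence, and let q : X₁ + X₂ → P present the pushout (X₁ + X₂)/θ.
--   * [f₁, f₂] identifies every generating pair of θ, so it factors through
--     the quotient: h ∘ q = [f₁, f₂] for some h : P → D.
--   * Conversely, by bitotality q ∘ ιᵢ is constant on the fibres of fᵢ, so
--     (classically) there is k : D → P with k ∘ fᵢ = q ∘ ιᵢ.  Off the image
--     of f₁ the map k needs some point of P; since P may be empty, we use a
--     family kᵤ indexed by the point u ∈ P at which λ is being evaluated.
--   * Whenever a morphism f : ⟨X, ξ⟩ → ⟨D, γ⟩ and a map p : X → P satisfy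
--     h ∘ p = f and kᵤ ∘ f = p, p is a morphism into ⟨P, u ↦ F(kᵤ)(γ(h u))⟩.
-- Applying the last fact to (f₁, q ∘ ι₁) and (f₂, q ∘ ι₂) gives the required
-- structure λ u = F(kᵤ)(γ(h u)) on the pushout.

open import Defs
open import Data.Empty using (⊥-elim)
open import Data.Product using (_,_; proj₁; proj₂; ∃)
open import Data.Sum using (_⊎_; inj₁; inj₂; [_,_])
open import Axiom.ExcludedMiddle using (ExcludedMiddle)
import Level
open import Function using (_∘_)
open import Relation.Nullary using (yes; no)
open import Relation.Binary.PropositionalEquality using (_≡_; refl; sym; trans; cong; isEquivalence; module ≡-Reasoning)
open import Relation.Binary.Construct.Closure.Equivalence using (gfold; return)

factorThroughQuotient :
  {X₁ X₂ P B : Set} (R : Relation X₁ X₂) (q : X₁ ⊎ X₂ → P) →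
  IsQuotientBy R P q → (g : X₁ ⊎ X₂ → B) →
  (∀ {x₁ x₂} → R x₁ x₂ → g (inj₁ x₁) ≡ g (inj₂ x₂)) →
  ∃ λ (h : P → B) → ∀ z → h (q z) ≡ g z
factorThroughQuotient {P = P} {B} R q (surj , ker) g respects =
  h , λ z → respectsθ (proj₁ (ker _ z) (proj₂ (surj (q z))))
  where
  respectsθ : ∀ {z w} → θ R z w → g z ≡ g w
  respectsθ = gfold isEquivalence g (λ { (gen r) → respects r })

  h : P → B
  h p = g (proj₁ (surj p))

extendAlong : ExcludedMiddle Level.zero → {X D P : Set} →
  (f : X → D) (g : X → P) → (∀ x x′ → f x ≡ f x′ → g x ≡ g x′) →
  P → ∃ λ (k : D → P) → ∀ x → k (f x) ≡ g x
extendAlong em {D = D} {P} f g constOnFibres default = k , k∘f≡g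
  where
  k : D → P
  k d with em {∃ λ x → f x ≡ d}
  ... | yes (x , _) = g x
  ... | no _        = default

  k∘f≡g : ∀ x → k (f x) ≡ g x
  k∘f≡g x with em {∃ λ x′ → f x′ ≡ f x}
  ... | yes (x′ , fx′≡fx) = constOnFibres x′ x fx′≡fx
  ... | no  noPreimage    = ⊥-elim (noPreimage (x , refl))

transportMorphism : (F : SetFunctor) (C D : Coalgebra F) {P : Set}
  (f : Carrier C → Carrier D) (p : Carrier C → P)
  (h : P → Carrier D) (k : P → Carrier D → P) →
  IsCoalgMorphism F C D f → (∀ x → h (p x) ≡ f x) → (∀ u x → k u (f x) ≡ p x) →
  IsCoalgMorphism F C ⟨ P , (λ u → fmap F (k u) (str D (h u))) ⟩ p
transportMorphism F C D f p h k isMor h∘p≡f k∘f≡p x = begin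
    fmap F p (str C x)                     ≡⟨ fmap-cong F (sym ∘ k∘f≡p (p x)) (str C x) ⟩
    fmap F (k (p x) ∘ f) (str C x)         ≡⟨ fmap-∘ F (k (p x)) f (str C x) ⟩
    fmap F (k (p x)) (fmap F f (str C x))  ≡⟨ cong (fmap F (k (p x))) (isMor x) ⟩
    fmap F (k (p x)) (str D (f x))         ≡⟨ cong (fmap F (k (p x)) ∘ str D) (sym (h∘p≡f x)) ⟩
    fmap F (k (p x)) (str D (h (p x)))     ∎
  where open ≡-Reasoning

lemma3p11 : ExcludedMiddle Level.zero →
    (F : SetFunctor) (C₁ C₂ : Coalgebra F)
    (R : Relation (Carrier C₁) (Carrier C₂)) →
    Bitotal R → Cocongruence F C₁ C₂ R →
    Precocongruence F C₁ C₂ R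
lemma3p11 em F C₁ C₂ R (tot₁ , tot₂) (D , f₁ , f₂ , mor₁ , mor₂ , kernel) P q quot@(_ , ker) =
  (λ u → fmap F (k u) (str D (h u))) ,
  transportMorphism F C₁ D f₁ (q ∘ inj₁) h k mor₁ (h∘q ∘ inj₁) k∘f₁ ,
  transportMorphism F C₂ D f₂ (q ∘ inj₂) h k mor₂ (h∘q ∘ inj₂) k∘f₂
  where
  glued : ∀ {x₁ x₂} → R x₁ x₂ → q (inj₁ x₁) ≡ q (inj₂ x₂)
  glued r = proj₂ (ker _ _) (return (gen r))

  h : P → Carrier D
  h = proj₁ (factorThroughQuotient R q quot [ f₁ , f₂ ] (proj₁ (kernel _ _)))

  h∘q : ∀ z → h (q z) ≡ [ f₁ , f₂ ] z
  h∘q = proj₂ (factorThroughQuotient R q quot [ f₁ , f₂ ] (proj₁ (kernel _ _)))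

  -- q ∘ ι₁ is constant on the fibres of f₁: both points are R-related to a
  -- common x₂, chosen by bitotality.
  constOnFibres : ∀ x x′ → f₁ x ≡ f₁ x′ → q (inj₁ x) ≡ q (inj₁ x′)
  constOnFibres x x′ fx≡fx′ with tot₁ x′
  ... | x₂ , rx′ = trans (glued (proj₂ (kernel x x₂) (trans fx≡fx′ (proj₁ (kernel x′ x₂) rx′))))
                         (sym (glued rx′))

  k : P → Carrier D → P
  k u = proj₁ (extendAlong em f₁ (q ∘ inj₁) constOnFibres u)

  k∘f₁ : ∀ u x₁ → k u (f₁ x₁) ≡ q (inj₁ x₁)
  k∘f₁ u = proj₂ (extendAlong em f₁ (q ∘ inj₁) constOnFibres u)

  -- By bitotality every x₂ is R-related to some x₁, whence f₂ x₂ = f₁ x₁.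
  k∘f₂ : ∀ u x₂ → k u (f₂ x₂) ≡ q (inj₂ x₂)
  k∘f₂ u x₂ with tot₂ x₂
  ... | x₁ , r = trans (cong (k u) (sym (proj₁ (kernel x₁ x₂) r))) (trans (k∘f₁ u x₁) (glued r))
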